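{- Let $p\geq 1$, $r\geq 1$ and $n\geq 1$ be integers. Then: (i) if $p=1$ and $n\leq r$, then $O\Gamma^{(p,r)}_{n}\cong Q_n$; (ii) if either $r=1$ and $n\leq p+1$, or $r\geq 2$ and $n\leq p$, then $O\Gamma^{(p,r)}_{n}\cong K_{1,n}$.
   Context: For positive integers $p,r,n$, a binary word $a_1a_2\ldots a_n$ is an O-Fibonacci $(p,r)$-word if (1) between any two $1$s there are at least $p-1$ zeros (i.e. if $a_i=1$ then $a_{i+1}=\dots=a_{i+p-1}=0$), and (2) there are at most $r$ "consecutive" $1$s, where two $1$s are called consecutive when exactly $p-1$ zeros separate them; equivalently the word contains at most $r$ consecutive copies of $10^{p-1}$, i.e. it does not contain the factor $(10^{p-1})^{r}1$. The O-Fibonacci $(p,r)$-cube $O\Gamma^{(p,r)}_{n}$ is the subgraph of the hypercube $Q_n$ (all binary words of length $n$, adjacent iff differing in exactly one coordinate) induced on the set of all O-Fibonacci $(p,r)$-words of length $n$. $K_{1,n}$ is the star with $n$ leaves. -}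

module Defs where

open import Data.Unit using (⊤)
open import Data.Empty using (⊥)
open import Data.Nat using (ℕ; zero; suc; _+_; _≤_; _<_; _∸_)
open import Data.Bool using (Bool; true; false)
open import Data.Fin using (Fin; toℕ)
open import Data.Vec using (Vec; lookup; toList)
open import Data.List using (List; []; _∷_; _++_; replicate; concat)
open import Data.Maybe using (Maybe; just; nothing)
open import Data.Product using (Σ; ∃; ∃-syntax; _×_; _,_; proj₁)
open import Relation.Binary.PropositionalEquality using (_≡_; _≢_)
open import Relation.Nullary using (¬_)
open import Function.Bundles using (_⇔_; Bijection)
open import Relation.Binary.Bundles using (Setoid)
open import Relation.Binary.PropositionalEquality using (setoid)
import Relation.Binary.Construct.On as On
open import Level using (0ℓ)

-- A graph: a vertex type and an adjacency relation.
-- Vertices form a setoid (V, _≈_) so that induced subgraphs on Σ-types can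
-- identify vertices by their underlying word (proof-irrelevantly).
record Graph : Set₁ where
  field
    VS  : Setoid 0ℓ 0ℓ
    Adj : Setoid.Carrier VS → Setoid.Carrier VS → Set
  V : Set
  V = Setoid.Carrier VS

open Graph public

_≅_ : Graph → Graph → Set
G ≅ H = Σ (Bijection (VS G) (VS H)) λ f →
  ∀ u v → Adj G u v ⇔ Adj H (Bijection.to f u) (Bijection.to f v)

DifferInExactlyOne : ∀ {n} → Vec Bool n → Vec Bool n → Set
DifferInExactlyOne {n} x y =
  ∃[ i ] (lookup x i ≢ lookup y i × (∀ j → j ≢ i → lookup x j ≡ lookup y j))

Q : ℕ → Graph
Q n = record { VS = setoid (Vec Bool n) ; Adj = DifferInExactlyOne }

K1 : ℕ → Graph
K1 n = record { VS = setoid (Maybe (Fin n)) ; Adj = StarAdj }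
  where
    StarAdj : Maybe (Fin n) → Maybe (Fin n) → Set
    StarAdj nothing  (just _) = ⊤
    StarAdj (just _) nothing  = ⊤
    StarAdj _        _        = ⊥

IsFactor : List Bool → List Bool → Set
IsFactor f w = ∃[ u ] ∃[ v ] (w ≡ u ++ f ++ v)

block : ℕ → List Bool
block p = true ∷ replicate (p ∸ 1) false

forbidden : ℕ → ℕ → List Bool
forbidden p r = concat (replicate r (block p)) ++ (true ∷ [])

-- O-Fibonacci (p,r)-word:
-- (1) if a_i = 1 then a_{i+1} = ... = a_{i+p-1} = 0, i.e. any two 1s at positions i<j satisfy j - i ≥ p;
-- (2) the word does not contain the factor (1 0^{p-1})^r 1.
IsOFib : (p r : ℕ) → ∀ {n} → Vec Bool n → Set
IsOFib p r {n} w =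
  (∀ (i j : Fin n) → toℕ i < toℕ j → lookup w i ≡ true → lookup w j ≡ true →
     p ≤ toℕ j ∸ toℕ i)
  × ¬ IsFactor (forbidden p r) (toList w)

OΓ : (p r n : ℕ) → Graph
OΓ p r n = record
  { VS  = On.setoid {B = Σ (Vec Bool n) (IsOFib p r)} (setoid (Vec Bool n)) (proj₁ {B = IsOFib p r})
  ; Adj = λ x y → DifferInExactlyOne (proj₁ x) (proj₁ y) }

-- (i) When p = 1 and n ≤ r, every binary word of length n is an O-Fibonacci
--     (1,r)-word: condition (1) is vacuous for p = 1, and the forbidden factor
--     (1)^r 1 has length r + 1 > n.  So OΓ is all of Q_n (`allWords⇒cube`).
-- (ii) In the star cases every O-Fibonacci word has at most one 1: if n ≤ p two
--     1s are closer than p (`short-words-sparse`); if r = 1 and n = p + 1 they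
--     must sit at both ends with only 0s between, i.e. the word is the
--     forbidden factor 1 0^{p-1} 1 itself (`full-words-sparse`).
--     Words with at most one 1 are the zero word and the unit words e_i; they
--     are all O-Fibonacci for r ≥ 1 (the forbidden factor has two 1s), and
--     e_i ↦ leaf i, 0 ↦ centre is an isomorphism onto K_{1,n}
--     (`atMostOne⇒star`), since two such words differ in exactly one place
--     iff one of them is the zero word and the other is not.
module Submission where

open import Defs
open import Data.Nat using (ℕ; zero; suc; _≤_; _≥_; _<_; _+_; _∸_; z≤n; s≤s)
open import Data.Nat.Properties
  using (≤-trans; ≤-pred; ≤-antisym; <⇒≱; <-≤-trans; ≤-<-trans; m≤m+n; m≤n+m;
         m≤n⇒m≤1+n; m∸n≤m; m<n⇒0<n∸m; m≤n⇒m<n∨m≡n; +-comm; <-irrefl; module ≤-Reasoning)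
open import Data.Unit using (tt)
open import Data.Empty using (⊥; ⊥-elim)
open import Data.Bool using (Bool; true; false)
open import Data.Bool.Properties using (¬-not)
open import Data.Fin using (Fin; toℕ; fromℕ; _≟_) renaming (zero to fz; suc to fs)
open import Data.Fin.Properties using (toℕ<n; toℕ-injective; toℕ-fromℕ)
open import Data.Vec using (Vec; []; _∷_; lookup; toList)
open import Data.Vec.Properties using (length-toList)
open import Data.List using (List; []; _∷_; _++_; length; replicate)
open import Data.List.Properties using (length-++; ++-identityʳ)
open import Data.Maybe using (Maybe; just; nothing)
import Data.Maybe as Maybe
open import Data.Maybe.Properties using (just-injective)
open import Data.Product using (Σ; _×_; proj₁; _,_)
open import Data.Sum using (_⊎_; inj₁; inj₂)
open import Relation.Binary.PropositionalEquality
  using (_≡_; refl; sym; trans; cong; cong₂; subst; subst₂; _≢_; ≢-sym; module ≡-Reasoning)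
open import Relation.Nullary using (yes; no)
open import Function using (id; _∘_)
open import Function.Bundles using (_⇔_; mk⇔; Bijection)

ones : List Bool → ℕ
ones []           = 0
ones (true ∷ xs)  = suc (ones xs)
ones (false ∷ xs) = ones xs

ones-++ : ∀ xs ys → ones (xs ++ ys) ≡ ones xs + ones ys
ones-++ []           ys = refl
ones-++ (true ∷ xs)  ys = cong suc (ones-++ xs ys)
ones-++ (false ∷ xs) ys = ones-++ xs ys

factor-≤ : (μ : List Bool → ℕ) → (∀ xs ys → μ (xs ++ ys) ≡ μ xs + μ ys) →
           ∀ {f w} → IsFactor f w → μ f ≤ μ w
factor-≤ μ additive {f} (u , v , refl) = begin
  μ f                 ≤⟨ m≤m+n (μ f) (μ v) ⟩
  μ f + μ v           ≤⟨ m≤n+m (μ f + μ v) (μ u) ⟩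
  μ u + (μ f + μ v)   ≡⟨ cong (μ u +_) (additive f v) ⟨
  μ u + μ (f ++ v)    ≡⟨ additive u (f ++ v) ⟨
  μ (u ++ f ++ v)     ∎
  where open ≤-Reasoning

-- The forbidden factor for p = 1 is 1^{r+1}, since forbidden 1 (suc r)
-- reduces to true ∷ forbidden 1 r.
length-forbidden-1 : ∀ r → length (forbidden 1 r) ≡ suc r
length-forbidden-1 zero    = refl
length-forbidden-1 (suc r) = cong suc (length-forbidden-1 r)

ones-ends-with-one : ∀ xs → 1 ≤ ones (xs ++ true ∷ [])
ones-ends-with-one []           = s≤s z≤n
ones-ends-with-one (true ∷ xs)  = m≤n⇒m≤1+n (ones-ends-with-one xs)
ones-ends-with-one (false ∷ xs) = ones-ends-with-one xs

-- For r ≥ 1 the forbidden factor begins and ends with a 1.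
ones-forbidden : ∀ p r → 2 ≤ ones (forbidden p (suc r))
ones-forbidden p r = s≤s (ones-ends-with-one (replicate (p ∸ 1) false ++ _))

forbidden-r1 : ∀ q → forbidden (suc q) 1 ≡ true ∷ replicate q false ++ true ∷ []
forbidden-r1 q = cong (λ zeros → true ∷ zeros ++ true ∷ []) (++-identityʳ (replicate q false))

AtMostOneOne : ∀ {n} → Vec Bool n → Set
AtMostOneOne {n} w =
  ∀ (i j : Fin n) → toℕ i < toℕ j → lookup w i ≡ true → lookup w j ≡ true → ⊥

unit : ∀ {n} → Maybe (Fin n) → Vec Bool n
unit {zero}  _              = []
unit {suc n} nothing        = false ∷ unit nothing
unit {suc n} (just fz)      = true ∷ unit nothing
unit {suc n} (just (fs i))  = false ∷ unit (just i)

firstOne : ∀ {n} → Vec Bool n → Maybe (Fin n)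
firstOne []          = nothing
firstOne (true ∷ _)  = just fz
firstOne (false ∷ w) = Maybe.map fs (firstOne w)

unit-shift : ∀ {n} (y : Maybe (Fin n)) → unit (Maybe.map fs y) ≡ false ∷ unit y
unit-shift nothing  = refl
unit-shift (just i) = refl

unit-lookup-true : ∀ {n} (y : Maybe (Fin n)) j → lookup (unit y) j ≡ true → y ≡ just j
unit-lookup-true nothing         fz     ()
unit-lookup-true nothing         (fs j) h = cong (Maybe.map fs) (unit-lookup-true nothing j h)
unit-lookup-true (just fz)       fz     _ = refl
unit-lookup-true (just fz)       (fs j) h with unit-lookup-true nothing j h
... | ()
unit-lookup-true (just (fs i))   fz     ()
unit-lookup-true (just (fs i))   (fs j) h = cong (Maybe.map fs) (unit-lookup-true (just i) j h)

unit-lookup-self : ∀ {n} (i : Fin n) → lookup (unit (just i)) i ≡ true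
unit-lookup-self fz     = refl
unit-lookup-self (fs i) = unit-lookup-self i

unit-lookup-other : ∀ {n} (y : Maybe (Fin n)) j → y ≢ just j → lookup (unit y) j ≡ false
unit-lookup-other y j y≢j = ¬-not (y≢j ∘ unit-lookup-true y j)

unit-sparse : ∀ {n} (y : Maybe (Fin n)) → AtMostOneOne (unit y)
unit-sparse y i j i<j yi yj = <-irrefl (cong toℕ (just-injective just-i≡just-j)) i<j
  where
  just-i≡just-j : just i ≡ just j
  just-i≡just-j = trans (sym (unit-lookup-true y i yi)) (unit-lookup-true y j yj)

firstOne-unit : ∀ {n} (y : Maybe (Fin n)) → firstOne (unit y) ≡ y
firstOne-unit {zero}  nothing       = refl
firstOne-unit {suc n} nothing       = cong (Maybe.map fs) (firstOne-unit nothing)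
firstOne-unit {suc n} (just fz)     = refl
firstOne-unit {suc n} (just (fs i)) = cong (Maybe.map fs) (firstOne-unit (just i))

zero-word : ∀ {n} (w : Vec Bool n) → (∀ j → lookup w j ≢ true) → unit nothing ≡ w
zero-word []          _        = refl
zero-word (true ∷ w)  no-ones  = ⊥-elim (no-ones fz refl)
zero-word (false ∷ w) no-ones  = cong (false ∷_) (zero-word w (no-ones ∘ fs))

unit-firstOne : ∀ {n} (w : Vec Bool n) → AtMostOneOne w → unit (firstOne w) ≡ w
unit-firstOne []          _      = refl
unit-firstOne (true ∷ w)  sparse =
  cong (true ∷_) (zero-word w (λ j → sparse fz (fs j) (s≤s z≤n) refl))
unit-firstOne (false ∷ w) sparse = begin
  unit (Maybe.map fs (firstOne w))  ≡⟨ unit-shift (firstOne w) ⟩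
  false ∷ unit (firstOne w)         ≡⟨ cong (false ∷_) (unit-firstOne w tail-sparse) ⟩
  false ∷ w                         ∎
  where
  open ≡-Reasoning
  tail-sparse : AtMostOneOne w
  tail-sparse i j i<j = sparse (fs i) (fs j) (s≤s i<j)

ones-zero-word : ∀ n → ones (toList (unit {n} nothing)) ≡ 0
ones-zero-word zero    = refl
ones-zero-word (suc n) = ones-zero-word n

ones-unit : ∀ {n} (y : Maybe (Fin n)) → ones (toList (unit y)) ≤ 1
ones-unit {zero}  _             = z≤n
ones-unit {suc n} nothing       = subst (_≤ 1) (sym (ones-zero-word n)) z≤n
ones-unit {suc n} (just fz)     = subst (λ k → suc k ≤ 1) (sym (ones-zero-word n)) (s≤s z≤n)
ones-unit {suc n} (just (fs i)) = ones-unit (just i)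

unit-OFib : ∀ p r {n} (y : Maybe (Fin n)) → IsOFib p (suc r) (unit y)
unit-OFib p r y =
    (λ i j i<j yi yj → ⊥-elim (unit-sparse y i j i<j yi yj))
  , λ factor → <⇒≱ (s≤s (ones-unit y))
                   (≤-trans (ones-forbidden p r) (factor-≤ ones ones-++ factor))

differ-sym : ∀ {n} {x y : Vec Bool n} → DifferInExactlyOne x y → DifferInExactlyOne y x
differ-sym (i , differ , agree) = i , ≢-sym differ , λ j j≢i → sym (agree j j≢i)

differ-only-at : ∀ {n} {x y : Vec Bool n} (d : DifferInExactlyOne x y) →
                 ∀ j → lookup x j ≢ lookup y j → j ≡ proj₁ d
differ-only-at (i , _ , agree) j differ with j ≟ i
... | yes j≡i = j≡i
... | no  j≢i = ⊥-elim (differ (agree j j≢i))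

false≢true : ∀ {a b : Bool} → a ≡ false → b ≡ true → a ≢ b
false≢true refl refl ()

centre-leaf : ∀ {n} (k : Fin n) → DifferInExactlyOne (unit nothing) (unit (just k))
centre-leaf k =
    k
  , false≢true (unit-lookup-other nothing k λ ()) (unit-lookup-self k)
  , λ j j≢k → trans (unit-lookup-other nothing j λ ())
                    (sym (unit-lookup-other (just k) j (j≢k ∘ sym ∘ just-injective)))

leaves-nonadjacent : ∀ {n} (k m : Fin n) → DifferInExactlyOne (unit (just k)) (unit (just m)) → ⊥
leaves-nonadjacent k m d@(_ , differ , _) with k ≟ m
... | yes refl = differ refl
... | no  k≢m  = k≢m (trans (differ-only-at {x = unit (just k)} {unit (just m)} d k at-k)
                                 (sym (differ-only-at {x = unit (just k)} {unit (just m)} d m at-m)))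
  where
  at-k : lookup (unit (just k)) k ≢ lookup (unit (just m)) k
  at-k = ≢-sym (false≢true (unit-lookup-other (just m) k (k≢m ∘ sym ∘ just-injective))
                           (unit-lookup-self k))
  at-m : lookup (unit (just k)) m ≢ lookup (unit (just m)) m
  at-m = false≢true (unit-lookup-other (just k) m (k≢m ∘ just-injective)) (unit-lookup-self m)

unit-adjacency : ∀ {n} (a b : Maybe (Fin n)) →
                 DifferInExactlyOne (unit a) (unit b) ⇔ Adj (K1 n) a b
unit-adjacency nothing  nothing  = mk⇔ (λ { (_ , differ , _) → differ refl }) λ ()
unit-adjacency nothing  (just k) = mk⇔ (λ _ → tt) (λ _ → centre-leaf k)
unit-adjacency (just k) nothing  =
  mk⇔ (λ _ → tt) (λ _ → differ-sym {x = unit nothing} {unit (just k)} (centre-leaf k))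
unit-adjacency (just k) (just m) = mk⇔ (leaves-nonadjacent k m) λ ()

allWords⇒cube : ∀ {p r n} → (∀ (w : Vec Bool n) → IsOFib p r w) → OΓ p r n ≅ Q n
allWords⇒cube {p} {r} {n} allOFib = forget , λ _ _ → mk⇔ id id
  where
  forget : Bijection (VS (OΓ p r n)) (VS (Q n))
  forget = record { to = proj₁ ; cong = id ; bijective = id , λ w → (w , allOFib w) , id }

atMostOne⇒star : ∀ {p r n} → 1 ≤ r →
                 (∀ (w : Vec Bool n) → IsOFib p r w → AtMostOneOne w) → OΓ p r n ≅ K1 n
atMostOne⇒star {p} {suc r} {n} (s≤s z≤n) sparse = bij , adjacency
  where
  Vertex : Set
  Vertex = Σ (Vec Bool n) (IsOFib p (suc r))
  recover : ∀ (u : Vertex) → unit (firstOne (proj₁ u)) ≡ proj₁ u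
  recover (w , ofib) = unit-firstOne w (sparse w ofib)
  bij : Bijection (VS (OΓ p (suc r) n)) (VS (K1 n))
  bij = record
    { to        = firstOne ∘ proj₁
    ; cong      = cong firstOne
    ; bijective = (λ {u} {v} same → trans (sym (recover u)) (trans (cong unit same) (recover v)))
                , λ y → (unit y , unit-OFib p r y) , λ u≡ → trans (cong firstOne u≡) (firstOne-unit y)
    }
  adjacency : ∀ u v → DifferInExactlyOne (proj₁ u) (proj₁ v) ⇔
                      Adj (K1 n) (firstOne (proj₁ u)) (firstOne (proj₁ v))
  adjacency u v = subst₂ (λ x y → DifferInExactlyOne x y ⇔ Adj (K1 n) a b)
                         (recover u) (recover v) (unit-adjacency a b)
    where
    a b : Maybe (Fin n)
    a = firstOne (proj₁ u)
    b = firstOne (proj₁ v)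

short-words-OFib : ∀ {r n} → n ≤ r → (w : Vec Bool n) → IsOFib 1 r w
short-words-OFib {r} n≤r w =
    (λ i j i<j _ _ → m<n⇒0<n∸m i<j)
  , λ factor → <⇒≱ (s≤s n≤r)
      (subst₂ _≤_ (length-forbidden-1 r) (length-toList w)
        (factor-≤ length (λ xs ys → length-++ xs) factor))

distance< : ∀ {n} (i j : Fin n) → toℕ j ∸ toℕ i < n
distance< i j = ≤-<-trans (m∸n≤m (toℕ j) (toℕ i)) (toℕ<n j)

short-words-sparse : ∀ {p r n} → n ≤ p → (w : Vec Bool n) → IsOFib p r w → AtMostOneOne w
short-words-sparse n≤p w (separated , _) i j i<j wi wj =
  <⇒≱ (<-≤-trans (distance< i j) n≤p) (separated i j i<j wi wj)

lone-last-one : ∀ q (w : Vec Bool (suc q)) → lookup w (fromℕ q) ≡ true →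
                (∀ m → toℕ m < q → lookup w m ≡ false) → toList w ≡ replicate q false ++ true ∷ []
lone-last-one zero    (b ∷ [])    b≡true _      = cong (_∷ []) b≡true
lone-last-one (suc q) (b ∷ w)     last   others =
  cong₂ _∷_ (others fz (s≤s z≤n)) (lone-last-one q w last λ m m<q → others (fs m) (s≤s m<q))

-- Part (ii), r = 1 and n = p + 1: two 1s must be the first and last letters
-- with only 0s between, so the word would be the forbidden factor 1 0^{p-1} 1.
full-words-sparse : ∀ q (w : Vec Bool (suc (suc q))) → IsOFib (suc q) 1 w → AtMostOneOne w
full-words-sparse q (x ∷ w) _                fz     fz     ()
full-words-sparse q (x ∷ w) _                (fs i) fz     ()
full-words-sparse q (x ∷ w) (separated , _)  (fs i) (fs j) i<j wi wj =
  <⇒≱ (distance< i j) (separated (fs i) (fs j) i<j wi wj)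
full-words-sparse q (x ∷ w) (separated , no-forbidden) fz (fs j) _ x≡true wj =
  no-forbidden ([] , [] , whole-word)
  where
  j≡last : j ≡ fromℕ q
  j≡last = toℕ-injective (trans (≤-antisym (≤-pred (toℕ<n j))
                                           (≤-pred (separated fz (fs j) (s≤s z≤n) x≡true wj)))
                                (sym (toℕ-fromℕ q)))
  gap : ∀ m → toℕ m < q → lookup w m ≡ false
  gap m m<q = ¬-not λ wm → <⇒≱ m<q (≤-pred (separated fz (fs m) (s≤s z≤n) x≡true wm))
  whole-word : toList (x ∷ w) ≡ forbidden (suc q) 1 ++ []
  whole-word = begin
    x ∷ toList w                          ≡⟨ cong₂ _∷_ x≡true (lone-last-one q w last-one gap) ⟩
    true ∷ replicate q false ++ true ∷ []  ≡⟨ forbidden-r1 q ⟨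
    forbidden (suc q) 1                   ≡⟨ ++-identityʳ _ ⟨
    forbidden (suc q) 1 ++ []             ∎
    where
    open ≡-Reasoning
    last-one : lookup w (fromℕ q) ≡ true
    last-one = subst (λ k → lookup w k ≡ true) j≡last wj

r1-words-sparse : ∀ {p n} → p ≥ 1 → n ≤ p + 1 → (w : Vec Bool n) → IsOFib p 1 w → AtMostOneOne w
r1-words-sparse {suc q} {n} _ n≤p+1 with m≤n⇒m<n∨m≡n (subst (n ≤_) (+-comm (suc q) 1) n≤p+1)
... | inj₁ n<p+1 = short-words-sparse {r = 1} (≤-pred n<p+1)
... | inj₂ refl  = full-words-sparse q

lemma3p1 : (p r n : ℕ) → p ≥ 1 → r ≥ 1 → n ≥ 1 →
    ((p ≡ 1 → n ≤ r → OΓ p r n ≅ Q n)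
    × (((r ≡ 1 × n ≤ p + 1) ⊎ (r ≥ 2 × n ≤ p)) → OΓ p r n ≅ K1 n))
lemma3p1 p r n p≥1 r≥1 _ = cube , star
  where
  cube : p ≡ 1 → n ≤ r → OΓ p r n ≅ Q n
  cube p≡1 n≤r = subst (λ p → OΓ p r n ≅ Q n) (sym p≡1) (allWords⇒cube {r = r} (short-words-OFib n≤r))
  star : ((r ≡ 1 × n ≤ p + 1) ⊎ (r ≥ 2 × n ≤ p)) → OΓ p r n ≅ K1 n
  star (inj₁ (r≡1 , n≤p+1)) = atMostOne⇒star r≥1
    (subst (λ r → ∀ w → IsOFib p r w → AtMostOneOne w) (sym r≡1) (r1-words-sparse p≥1 n≤p+1))
  star (inj₂ (_ , n≤p))     = atMostOne⇒star r≥1 (short-words-sparse {r = r} n≤p)
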